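{- Let $m$ be a positive integer with $m\equiv 2\pmod{12}$. Then the rose window graph $R_{12m}(3m+2,9m+1)$ is a Cayley graph.
   Context: For integers $n\ge 3$ and $1\le a,r\le n-1$, the rose window graph $R_n(a,r)$ has vertex set $\{A_i,B_i : i\in\mathbb{Z}_n\}$ and edges $A_iA_{i+1}$, $A_iB_i$, $A_{i+a}B_i$ and $B_iB_{i+r}$, indices taken modulo $n$. A graph is Cayley iff its automorphism group has a subgroup acting regularly on its vertices. -}

module Defs where

open import Data.Nat using (ℕ; zero; suc; _+_)
open import Data.Nat.DivMod using (_mod_)
open import Data.Fin using (Fin; toℕ)
open import Data.Product using (_×_; ∃)
open import Data.Sum using (_⊎_)
open import Function using (_∘_; id; _⇔_)
open import Relation.Binary.PropositionalEquality using (_≡_)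

addMod : (n : ℕ) → Fin n → ℕ → Fin n
addMod (suc n) i k = (toℕ i + k) mod (suc n)

data Vtx (n : ℕ) : Set where
  A B : Fin n → Vtx n

data Edge (n a r : ℕ) : Vtx n → Vtx n → Set where
  rim   : ∀ i → Edge n a r (A i) (A (addMod n i 1))
  spoke : ∀ i → Edge n a r (A i) (B i)
  cospoke : ∀ i → Edge n a r (A (addMod n i a)) (B i)
  hub   : ∀ i → Edge n a r (B i) (B (addMod n i r))

Adj : (n a r : ℕ) → Vtx n → Vtx n → Set
Adj n a r u v = Edge n a r u v ⊎ Edge n a r v u

record IsAutomorphism (n a r : ℕ) (f : Vtx n → Vtx n) : Set where
  field
    injective  : ∀ u v → f u ≡ f v → u ≡ v
    surjective : ∀ v → ∃ λ u → f u ≡ v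
    preserves  : ∀ u v → Adj n a r u v ⇔ Adj n a r (f u) (f v)

-- A subgroup G of Aut(R_n(a,r)) (given as a predicate on maps, elements
-- identified pointwise) acting regularly on the vertex set.
record RegularAutSubgroup (n a r : ℕ) : Set₁ where
  field
    G       : (Vtx n → Vtx n) → Set
    isAut   : ∀ g → G g → IsAutomorphism n a r g
    id∈     : G id
    comp∈   : ∀ g h → G g → G h → G (g ∘ h)
    inv∈    : ∀ g → G g → ∃ λ h → G h × (∀ x → h (g x) ≡ x) × (∀ x → g (h x) ≡ x)
    transitive : ∀ u v → ∃ λ g → G g × g u ≡ v
    free    : ∀ g → G g → ∀ u → g u ≡ u → ∀ x → g x ≡ x

-- Cayley graph: Aut has a subgroup acting regularly on the vertices
IsCayleyRoseWindow : (n a r : ℕ) → Set₁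
IsCayleyRoseWindow n a r = RegularAutSubgroup n a r

-- Let n = 12m, a = 3m + 2, r = 9m + 1 and u = 3m - 1. Since m ≡ 2 (mod 4),
-- u² ≡ 1, r ≡ -u and (u + 1)a ≡ 0 (mod n), and these three congruences are exactly what
-- makes the maps  A_i ↦ A_{i+k}, B_i ↦ B_{i+k}  (rotations) and  A_i ↦ B_{ui+k}, B_i ↦ A_{ui+k}
-- (flips) automorphisms: a flip exchanges rims with hubs and maps spokes and co-spokes to
-- themselves. These 2n maps compose affinely in the index, so they form a group, and it acts
-- regularly because the offset k is determined by the image of a single vertex.
module Submission where

open import Defs
open import Data.Fin using (Fin; toℕ)
open import Data.Fin.Properties using (toℕ-injective; toℕ<n; toℕ-fromℕ<)
open import Data.List using ([]; _∷_)
open import Data.Nat using (ℕ; NonZero; suc; pred; _+_; _*_; _%_; _/_; _≤_)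
open import Data.Nat.Divisibility using (divides; n∣m*n)
open import Data.Nat.DivMod
  using (_mod_; %-distribˡ-+; %-distribˡ-*; %-remove-+ʳ; m%n%n≡m%n; m%n<n; m<n⇒m%n≡m; m*n%n≡0;
         m≡m%n+[m/n]*n; m∣n⇒o%n%m≡o%m)
open import Data.Nat.Properties using (*-comm; *-zeroʳ; *-identityˡ; *-identityʳ; *-distribˡ-+; +-identityʳ; +-assoc; +-comm)
open import Data.Nat.Tactic.RingSolver using (solve; solve-∀)
open import Data.Product using (_×_; ∃; _,_)
open import Data.Sum using (inj₁; inj₂)
import Data.Sum as Sum
open import Function using (_∘_; id; mk⇔)
open import Relation.Binary.Bundles using (Setoid)
open import Relation.Binary.Structures using (IsEquivalence)
open import Relation.Binary.PropositionalEquality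
  using (_≡_; _≗_; refl; sym; trans; cong; cong₂; subst; subst₂; module ≡-Reasoning)
import Relation.Binary.Reasoning.Setoid as SetoidReasoning

infix 4 _≡_[mod_]
record _≡_[mod_] (x y N : ℕ) .{{_ : NonZero N}} : Set where
  constructor mod-≡
  field %-≡ : x % N ≡ y % N
open _≡_[mod_]

module Congruence (n : ℕ) where

  N : ℕ
  N = suc n

  infix 4 _≈_
  _≈_ : ℕ → ℕ → Set
  x ≈ y = x ≡ y [mod N ]

  ≈-isEquivalence : IsEquivalence _≈_
  ≈-isEquivalence = record
    { refl  = mod-≡ refl
    ; sym   = λ x≈y → mod-≡ (sym (%-≡ x≈y))
    ; trans = λ x≈y y≈z → mod-≡ (trans (%-≡ x≈y) (%-≡ y≈z))
    }

  ≈-setoid : Setoid _ _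
  ≈-setoid = record { isEquivalence = ≈-isEquivalence }

  open IsEquivalence ≈-isEquivalence public
    using () renaming (refl to ≈-refl; sym to ≈-sym; trans to ≈-trans)
  module ≈-Reasoning = SetoidReasoning ≈-setoid

  ≡⇒≈ : ∀ {x y} → x ≡ y → x ≈ y
  ≡⇒≈ refl = ≈-refl

  +-cong : ∀ {x y z w} → x ≈ y → z ≈ w → x + z ≈ y + w
  +-cong {x} {y} {z} {w} (mod-≡ x≡y) (mod-≡ z≡w) = mod-≡ (begin
    (x + z) % N           ≡⟨ %-distribˡ-+ x z N ⟩
    (x % N + z % N) % N   ≡⟨ cong₂ (λ s t → (s + t) % N) x≡y z≡w ⟩
    (y % N + w % N) % N   ≡⟨ %-distribˡ-+ y w N ⟨
    (y + w) % N           ∎)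
    where open ≡-Reasoning

  *-cong : ∀ {x y z w} → x ≈ y → z ≈ w → x * z ≈ y * w
  *-cong {x} {y} {z} {w} (mod-≡ x≡y) (mod-≡ z≡w) = mod-≡ (begin
    (x * z) % N           ≡⟨ %-distribˡ-* x z N ⟩
    (x % N * (z % N)) % N ≡⟨ cong₂ (λ s t → (s * t) % N) x≡y z≡w ⟩
    (y % N * (w % N)) % N ≡⟨ %-distribˡ-* y w N ⟨
    (y * w) % N           ∎)
    where open ≡-Reasoning

  +-congˡ : ∀ x {z w} → z ≈ w → x + z ≈ x + w
  +-congˡ x = +-cong (≈-refl {x})

  +-congʳ : ∀ {x y} z → x ≈ y → x + z ≈ y + z
  +-congʳ z x≈y = +-cong x≈y (≈-refl {z})

  -- n * x = (N - 1) * x serves as additive inverse, since x + n * x = N * x.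
  -_ : ℕ → ℕ
  - x = n * x

  +-inverseʳ : ∀ x → x + - x ≈ 0
  +-inverseʳ x = mod-≡ (trans (cong (_% N) (*-comm N x)) (m*n%n≡0 x N))

  +-inverseˡ : ∀ x → - x + x ≈ 0
  +-inverseˡ x = ≈-trans (≡⇒≈ (+-comm (- x) x)) (+-inverseʳ x)

  ≈0⇒+-identityʳ : ∀ x {z} → z ≈ 0 → x + z ≈ x
  ≈0⇒+-identityʳ x z≈0 = ≈-trans (+-congˡ x z≈0) (≡⇒≈ (+-identityʳ x))

  +-cancelˡ-≈0 : ∀ x {k} → x + k ≈ x → k ≈ 0
  +-cancelˡ-≈0 x {k} x+k≈x = begin
    k             ≈⟨ ≈0⇒+-identityʳ k (+-inverseˡ x) ⟨
    k + (- x + x) ≡⟨ +-comm k (- x + x) ⟩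
    - x + x + k   ≡⟨ +-assoc (- x) x k ⟩
    - x + (x + k) ≈⟨ +-congˡ (- x) x+k≈x ⟩
    - x + x       ≈⟨ +-inverseˡ x ⟩
    0             ∎
    where open ≈-Reasoning

  +-inverse-cancel : ∀ x y → x + (y + - x) ≈ y
  +-inverse-cancel x y = begin
    x + (y + - x) ≡⟨ +-comm x (y + - x) ⟩
    y + - x + x   ≡⟨ +-assoc y (- x) x ⟩
    y + (- x + x) ≈⟨ ≈0⇒+-identityʳ y (+-inverseˡ x) ⟩
    y             ∎
    where open ≈-Reasoning

  +-≈0-cancel : ∀ x k e → x + e ≈ 0 → x + (k + e) ≈ k
  +-≈0-cancel x k e x+e≈0 = begin
    x + (k + e) ≡⟨ solve (x ∷ k ∷ e ∷ []) ⟩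
    k + (x + e) ≈⟨ ≈0⇒+-identityʳ k x+e≈0 ⟩
    k           ∎
    where open ≈-Reasoning

  toℕ-mod : ∀ x → toℕ (x mod N) ≈ x
  toℕ-mod x = mod-≡ (trans (cong (_% N) (toℕ-fromℕ< (m%n<n x N))) (m%n%n≡m%n x N))

  mod-cong : ∀ {x y} → x ≈ y → x mod N ≡ y mod N
  mod-cong {x} {y} (mod-≡ x%≡y%) =
    toℕ-injective (trans (toℕ-fromℕ< (m%n<n x N)) (trans x%≡y% (sym (toℕ-fromℕ< (m%n<n y N)))))

  mod-toℕ : ∀ (i : Fin N) → toℕ i mod N ≡ i
  mod-toℕ i = toℕ-injective (trans (toℕ-fromℕ< (m%n<n (toℕ i) N)) (m<n⇒m%n≡m (toℕ<n i)))

  ≡+multiple⇒≈ : ∀ {x} y c → x ≡ y + c * N → x ≈ y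
  ≡+multiple⇒≈ y c refl = mod-≡ (%-remove-+ʳ y (n∣m*n c))

  ≈toℕ⇒mod≡ : ∀ {x} (i : Fin N) → x ≈ toℕ i → x mod N ≡ i
  ≈toℕ⇒mod≡ i x≈i = trans (mod-cong x≈i) (mod-toℕ i)

  addMod-≈0 : ∀ i {k} → k ≈ 0 → addMod N i k ≡ i
  addMod-≈0 i k≈0 = ≈toℕ⇒mod≡ i (≈0⇒+-identityʳ (toℕ i) k≈0)

  addMod-fixed⇒≈0 : ∀ i k → addMod N i k ≡ i → k ≈ 0
  addMod-fixed⇒≈0 i k i+k≡i =
    +-cancelˡ-≈0 (toℕ i) (≈-trans (≈-sym (toℕ-mod (toℕ i + k))) (≡⇒≈ (cong toℕ i+k≡i)))

  addMod-difference : ∀ i j → addMod N i (toℕ j + - toℕ i) ≡ j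
  addMod-difference i j = ≈toℕ⇒mod≡ j (+-inverse-cancel (toℕ i) (toℕ j))

  addMod-addMod : ∀ i l k → addMod N (addMod N i l) k ≡ addMod N i (l + k)
  addMod-addMod i l k = mod-cong (begin
    toℕ (addMod N i l) + k ≈⟨ +-congʳ k (toℕ-mod (toℕ i + l)) ⟩
    toℕ i + l + k          ≡⟨ +-assoc (toℕ i) l k ⟩
    toℕ i + (l + k)        ∎)
    where open ≈-Reasoning

  addMod-comm : ∀ i k d → addMod N (addMod N i k) d ≡ addMod N (addMod N i d) k
  addMod-comm i k d = begin
    addMod N (addMod N i k) d ≡⟨ addMod-addMod i k d ⟩
    addMod N i (k + d)        ≡⟨ cong (addMod N i) (+-comm k d) ⟩
    addMod N i (d + k)        ≡⟨ addMod-addMod i d k ⟨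
    addMod N (addMod N i d) k ∎
    where open ≡-Reasoning

rim≡ : ∀ {n a r i j} → addMod n i 1 ≡ j → Edge n a r (A i) (A j)
rim≡ refl = rim _

cospoke≡ : ∀ {n a r i j} → addMod n i a ≡ j → Edge n a r (A j) (B i)
cospoke≡ refl = cospoke _

hub≡ : ∀ {n a r i j} → addMod n i r ≡ j → Edge n a r (B i) (B j)
hub≡ refl = hub _

∘-cong : ∀ {A B C : Set} {g g′ : B → C} {f f′ : A → B} → g ≗ g′ → f ≗ f′ → g ∘ f ≗ g′ ∘ f′
∘-cong {g′ = g′} g≗g′ f≗f′ x = trans (g≗g′ _) (cong g′ (f≗f′ x))

PreservesAdj : (n a r : ℕ) → (Vtx n → Vtx n) → Set
PreservesAdj n a r f = ∀ {x y} → Adj n a r x y → Adj n a r (f x) (f y)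

≗-preservesAdj : ∀ {n a r} {f g : Vtx n → Vtx n} → f ≗ g → PreservesAdj n a r g → PreservesAdj n a r f
≗-preservesAdj {n} {a} {r} f≗g g-adj {x} {y} x∼y = subst₂ (Adj n a r) (sym (f≗g x)) (sym (f≗g y)) (g-adj x∼y)

inverses⇒automorphism : ∀ {n a r} {f g : Vtx n → Vtx n} → g ∘ f ≗ id → f ∘ g ≗ id →
                        PreservesAdj n a r f → PreservesAdj n a r g → IsAutomorphism n a r f
inverses⇒automorphism {n} {a} {r} {f} {g} gf≗id fg≗id f-adj g-adj = record
  { injective  = λ x y fx≡fy → trans (sym (gf≗id x)) (trans (cong g fx≡fy) (gf≗id y))
  ; surjective = λ y → g y , fg≗id y
  ; preserves  = λ x y → mk⇔ f-adj (λ fx∼fy → subst₂ (Adj n a r) (gf≗id x) (gf≗id y) (g-adj fx∼fy))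
  }

index : ∀ {n} → Vtx n → Fin n
index (A i) = i
index (B i) = i

module AffineAutomorphisms (n a r u : ℕ)
  (u+r≈0 : u + r ≡ 0 [mod suc n ])
  (u*u≈1 : u * u ≡ 1 [mod suc n ])
  (u*a+a≈0 : u * a + a ≡ 0 [mod suc n ]) where

  open Congruence n

  u*r+1≈0 : u * r + 1 ≈ 0
  u*r+1≈0 = begin
    u * r + 1     ≈⟨ +-congˡ (u * r) u*u≈1 ⟨
    u * r + u * u ≡⟨ *-distribˡ-+ u r u ⟨
    u * (r + u)   ≈⟨ *-cong (≈-refl {u}) (≈-trans (≡⇒≈ (+-comm r u)) u+r≈0) ⟩
    u * 0         ≡⟨ *-zeroʳ u ⟩
    0             ∎
    where open ≈-Reasoning

  twist : ℕ → Fin N → Fin N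
  twist k i = (u * toℕ i + k) mod N

  rotate : ℕ → Vtx N → Vtx N
  rotate k (A i) = A (addMod N i k)
  rotate k (B i) = B (addMod N i k)

  flip : ℕ → Vtx N → Vtx N
  flip k (A i) = B (twist k i)
  flip k (B i) = A (twist k i)

  twist-cong : ∀ i {k l} → k ≈ l → twist k i ≡ twist l i
  twist-cong i k≈l = mod-cong (+-congˡ (u * toℕ i) k≈l)

  addMod-twist : ∀ l k i → addMod N (twist l i) k ≡ twist (l + k) i
  addMod-twist l k i = mod-cong (begin
    toℕ (twist l i) + k ≈⟨ +-congʳ k (toℕ-mod (u * toℕ i + l)) ⟩
    u * toℕ i + l + k   ≡⟨ +-assoc (u * toℕ i) l k ⟩
    u * toℕ i + (l + k) ∎)
    where open ≈-Reasoning

  twist-addMod : ∀ k l i → twist k (addMod N i l) ≡ twist (u * l + k) i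
  twist-addMod k l i = mod-cong (begin
    u * toℕ (addMod N i l) + k ≈⟨ +-congʳ k (*-cong (≈-refl {u}) (toℕ-mod (toℕ i + l))) ⟩
    u * (toℕ i + l) + k        ≡⟨ cong (_+ k) (*-distribˡ-+ u (toℕ i) l) ⟩
    u * toℕ i + u * l + k      ≡⟨ +-assoc (u * toℕ i) (u * l) k ⟩
    u * toℕ i + (u * l + k)    ∎)
    where open ≈-Reasoning

  twist-twist : ∀ k l i → twist k (twist l i) ≡ addMod N i (u * l + k)
  twist-twist k l i = mod-cong (begin
    u * toℕ (twist l i) + k     ≈⟨ +-congʳ k (*-cong (≈-refl {u}) (toℕ-mod (u * toℕ i + l))) ⟩
    u * (u * toℕ i + l) + k     ≡⟨ expand (toℕ i) ⟩
    u * u * toℕ i + (u * l + k) ≈⟨ +-congʳ (u * l + k) (*-cong u*u≈1 (≈-refl {toℕ i})) ⟩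
    1 * toℕ i + (u * l + k)     ≡⟨ cong (_+ (u * l + k)) (*-identityˡ (toℕ i)) ⟩
    toℕ i + (u * l + k)         ∎)
    where
      open ≈-Reasoning
      expand : ∀ x → u * (u * x + l) + k ≡ u * u * x + (u * l + k)
      expand x = solve (u ∷ x ∷ l ∷ k ∷ [])

  addMod-twist-cancel : ∀ k i {d e} → u * d + e ≈ 0 → addMod N (twist k (addMod N i d)) e ≡ twist k i
  addMod-twist-cancel k i {d} {e} ud+e≈0 = begin
    addMod N (twist k (addMod N i d)) e ≡⟨ addMod-twist k e (addMod N i d) ⟩
    twist (k + e) (addMod N i d)        ≡⟨ twist-addMod (k + e) d i ⟩
    twist (u * d + (k + e)) i           ≡⟨ twist-cong i (+-≈0-cancel (u * d) k e ud+e≈0) ⟩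
    twist k i                           ∎
    where open ≡-Reasoning

  rotate-rotate : ∀ k l → rotate k ∘ rotate l ≗ rotate (l + k)
  rotate-rotate k l (A i) = cong A (addMod-addMod i l k)
  rotate-rotate k l (B i) = cong B (addMod-addMod i l k)

  rotate-flip : ∀ k l → rotate k ∘ flip l ≗ flip (l + k)
  rotate-flip k l (A i) = cong B (addMod-twist l k i)
  rotate-flip k l (B i) = cong A (addMod-twist l k i)

  flip-rotate : ∀ k l → flip k ∘ rotate l ≗ flip (u * l + k)
  flip-rotate k l (A i) = cong B (twist-addMod k l i)
  flip-rotate k l (B i) = cong A (twist-addMod k l i)

  flip-flip : ∀ k l → flip k ∘ flip l ≗ rotate (u * l + k)
  flip-flip k l (A i) = cong A (twist-twist k l i)
  flip-flip k l (B i) = cong B (twist-twist k l i)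

  rotate-≈0 : ∀ {k} → k ≈ 0 → rotate k ≗ id
  rotate-≈0 k≈0 (A i) = cong A (addMod-≈0 i k≈0)
  rotate-≈0 k≈0 (B i) = cong B (addMod-≈0 i k≈0)

  rotate-fixed⇒≈0 : ∀ k x → rotate k x ≡ x → k ≈ 0
  rotate-fixed⇒≈0 k (A i) fixed = addMod-fixed⇒≈0 i k (cong index fixed)
  rotate-fixed⇒≈0 k (B i) fixed = addMod-fixed⇒≈0 i k (cong index fixed)

  rotate-inverseˡ : ∀ k → rotate (- k) ∘ rotate k ≗ id
  rotate-inverseˡ k x = trans (rotate-rotate (- k) k x) (rotate-≈0 (+-inverseʳ k) x)

  rotate-inverseʳ : ∀ k → rotate k ∘ rotate (- k) ≗ id
  rotate-inverseʳ k x = trans (rotate-rotate k (- k) x) (rotate-≈0 (+-inverseˡ k) x)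

  flip-inverseˡ : ∀ k → flip (- (u * k)) ∘ flip k ≗ id
  flip-inverseˡ k x = trans (flip-flip (- (u * k)) k x) (rotate-≈0 (+-inverseʳ (u * k)) x)

  flip-inverseʳ : ∀ k → flip k ∘ flip (- (u * k)) ≗ id
  flip-inverseʳ k x = trans (flip-flip k (- (u * k)) x) (rotate-≈0 u[-uk]+k≈0 x)
    where
      u[-uk]+k≈0 : u * - (u * k) + k ≈ 0
      u[-uk]+k≈0 = begin
        u * (n * (u * k)) + k ≡⟨ cong (_+ k) (solve (u ∷ n ∷ k ∷ [])) ⟩
        u * u * (n * k) + k   ≈⟨ +-congʳ k (*-cong u*u≈1 (≈-refl {n * k})) ⟩
        1 * (n * k) + k       ≡⟨ cong (_+ k) (*-identityˡ (n * k)) ⟩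
        - k + k               ≈⟨ +-inverseˡ k ⟩
        0                     ∎
        where open ≈-Reasoning

  rotate-edge : ∀ k {x y} → Edge N a r x y → Edge N a r (rotate k x) (rotate k y)
  rotate-edge k (rim i)     = rim≡ (addMod-comm i k 1)
  rotate-edge k (spoke i)   = spoke _
  rotate-edge k (cospoke i) = cospoke≡ (addMod-comm i k a)
  rotate-edge k (hub i)     = hub≡ (addMod-comm i k r)

  flip-edge : ∀ k {x y} → Edge N a r x y → Edge N a r (flip k y) (flip k x)
  flip-edge k (rim i)     = hub≡ (addMod-twist-cancel k i (≈-trans (+-congʳ r (≡⇒≈ (*-identityʳ u))) u+r≈0))
  flip-edge k (spoke i)   = spoke _
  flip-edge k (cospoke i) = cospoke≡ (addMod-twist-cancel k i u*a+a≈0)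
  flip-edge k (hub i)     = rim≡ (addMod-twist-cancel k i u*r+1≈0)

  rotate-preservesAdj : ∀ k → PreservesAdj N a r (rotate k)
  rotate-preservesAdj k = Sum.map (rotate-edge k) (rotate-edge k)

  flip-preservesAdj : ∀ k → PreservesAdj N a r (flip k)
  flip-preservesAdj k = Sum.swap ∘ Sum.map (flip-edge k) (flip-edge k)

  IsRotationOrFlip : (Vtx N → Vtx N) → Set
  IsRotationOrFlip g = ∃ λ k → (g ≗ rotate k) Sum.⊎ (g ≗ flip k)

  ∘-closed : ∀ g h → IsRotationOrFlip g → IsRotationOrFlip h → IsRotationOrFlip (g ∘ h)
  ∘-closed g h (k , inj₁ g≗) (l , inj₁ h≗) = l + k     , inj₁ λ x → trans (∘-cong g≗ h≗ x) (rotate-rotate k l x)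
  ∘-closed g h (k , inj₁ g≗) (l , inj₂ h≗) = l + k     , inj₂ λ x → trans (∘-cong g≗ h≗ x) (rotate-flip k l x)
  ∘-closed g h (k , inj₂ g≗) (l , inj₁ h≗) = u * l + k , inj₂ λ x → trans (∘-cong g≗ h≗ x) (flip-rotate k l x)
  ∘-closed g h (k , inj₂ g≗) (l , inj₂ h≗) = u * l + k , inj₁ λ x → trans (∘-cong g≗ h≗ x) (flip-flip k l x)

  inverse : ∀ g → IsRotationOrFlip g → ∃ λ h → IsRotationOrFlip h × (h ∘ g ≗ id) × (g ∘ h ≗ id)
  inverse g (k , inj₁ g≗) =
    rotate (- k) , (- k , inj₁ λ _ → refl) ,
    (λ x → trans (cong (rotate (- k)) (g≗ x)) (rotate-inverseˡ k x)) ,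
    (λ x → trans (g≗ _) (rotate-inverseʳ k x))
  inverse g (k , inj₂ g≗) =
    flip (- (u * k)) , (- (u * k) , inj₂ λ _ → refl) ,
    (λ x → trans (cong (flip (- (u * k))) (g≗ x)) (flip-inverseˡ k x)) ,
    (λ x → trans (g≗ _) (flip-inverseʳ k x))

  preservesAdj : ∀ g → IsRotationOrFlip g → PreservesAdj N a r g
  preservesAdj g (k , inj₁ g≗) = ≗-preservesAdj g≗ (rotate-preservesAdj k)
  preservesAdj g (k , inj₂ g≗) = ≗-preservesAdj g≗ (flip-preservesAdj k)

  automorphism : ∀ g → IsRotationOrFlip g → IsAutomorphism N a r g
  automorphism g g∈ with inverse g g∈
  ... | h , h∈ , hg≗id , gh≗id = inverses⇒automorphism hg≗id gh≗id (preservesAdj g g∈) (preservesAdj h h∈)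

  twist-difference : ∀ i j → twist (toℕ j + - (u * toℕ i)) i ≡ j
  twist-difference i j = ≈toℕ⇒mod≡ j (+-inverse-cancel (u * toℕ i) (toℕ j))

  transitive : ∀ x y → ∃ λ g → IsRotationOrFlip g × g x ≡ y
  transitive (A i) (A j) = rotate _ , (_ , inj₁ λ _ → refl) , cong A (addMod-difference i j)
  transitive (B i) (B j) = rotate _ , (_ , inj₁ λ _ → refl) , cong B (addMod-difference i j)
  transitive (A i) (B j) = flip _ , (_ , inj₂ λ _ → refl) , cong B (twist-difference i j)
  transitive (B i) (A j) = flip _ , (_ , inj₂ λ _ → refl) , cong A (twist-difference i j)

  free : ∀ g → IsRotationOrFlip g → ∀ x → g x ≡ x → g ≗ id
  free g (k , inj₁ g≗) x gx≡x y = trans (g≗ y) (rotate-≈0 (rotate-fixed⇒≈0 k x (trans (sym (g≗ x)) gx≡x)) y)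
  free g (k , inj₂ g≗) (A i) gx≡x y with () ← trans (sym (g≗ (A i))) gx≡x
  free g (k , inj₂ g≗) (B i) gx≡x y with () ← trans (sym (g≗ (B i))) gx≡x

  regularAutSubgroup : RegularAutSubgroup N a r
  regularAutSubgroup = record
    { G          = IsRotationOrFlip
    ; isAut      = automorphism
    ; id∈        = 0 , inj₁ λ x → sym (rotate-≈0 ≈-refl x)
    ; comp∈      = ∘-closed
    ; inv∈       = inverse
    ; transitive = transitive
    ; free       = free
    }

rose-window-cayley-2+4t : ∀ t → let m = 2 + 4 * t in
  IsCayleyRoseWindow (12 * m) (3 * m + 2) (9 * m + 1)
rose-window-cayley-2+4t t =
  AffineAutomorphisms.regularAutSubgroup (pred (12 * m)) (3 * m + 2) (9 * m + 1) (5 + 12 * t)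
    (≡+multiple⇒≈ 0 1 (u+r≡ t))
    (≡+multiple⇒≈ 1 (1 + 3 * t) (u*u≡ t))
    (≡+multiple⇒≈ 0 (2 + 3 * t) (u*a+a≡ t))
  where
    m = 2 + 4 * t
    open Congruence (pred (12 * m))

    -- 5 + 12t = 3m - 1
    u+r≡ : ∀ s → let m = 2 + 4 * s in (5 + 12 * s) + (9 * m + 1) ≡ 0 + 1 * (12 * m)
    u+r≡ = solve-∀
    u*u≡ : ∀ s → (5 + 12 * s) * (5 + 12 * s) ≡ 1 + (1 + 3 * s) * (12 * (2 + 4 * s))
    u*u≡ = solve-∀
    u*a+a≡ : ∀ s → let m = 2 + 4 * s in (5 + 12 * s) * (3 * m + 2) + (3 * m + 2) ≡ 0 + (2 + 3 * s) * (12 * m)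
    u*a+a≡ = solve-∀

rose-window-cayley : ∀ m → m % 4 ≡ 2 → IsCayleyRoseWindow (12 * m) (3 * m + 2) (9 * m + 1)
rose-window-cayley m m%4≡2 =
  subst (λ m → IsCayleyRoseWindow (12 * m) (3 * m + 2) (9 * m + 1)) (sym m≡2+4t)
        (rose-window-cayley-2+4t (m / 4))
  where
    m≡2+4t : m ≡ 2 + 4 * (m / 4)
    m≡2+4t = begin
      m                 ≡⟨ m≡m%n+[m/n]*n m 4 ⟩
      m % 4 + m / 4 * 4 ≡⟨ cong₂ _+_ m%4≡2 (*-comm (m / 4) 4) ⟩
      2 + 4 * (m / 4)   ∎
      where open ≡-Reasoning

-- The hypothesis 1 ≤ m is implied by m % 12 ≡ 2.
mainTheorem14 : (m : ℕ) → 1 ≤ m → m % 12 ≡ 2 →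
    IsCayleyRoseWindow (12 * m) (3 * m + 2) (9 * m + 1)
mainTheorem14 m _ m%12≡2 =
  rose-window-cayley m (trans (sym (m∣n⇒o%n%m≡o%m 4 12 m (divides 3 refl))) (cong (_% 4) m%12≡2))
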